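{- Let $A$ and $B$ be two asynchronously composable IOTSes that are weakly asynchronously compatible. If $A\otimes B^\rhd_{\mathit{out}_{BA}}$ is autonomously deadlock-free or $A^\rhd_{\mathit{out}_{AB}}\otimes B$ is autonomously deadlock-free, then $A\otimes_{as}B$ is asynchronously deadlock-free.
   Context: An IOTS $A=(\mathit{states}_A,\mathit{start}_A,\mathit{act}_A,\to_A)$ has states, initial state, actions $\mathit{act}_A=\mathit{in}_A\cup\mathit{out}_A\cup\mathit{int}_A$ (disjoint union of inputs, outputs, internal actions) and transitions $s\xrightarrow{a}_A s'$. $s\ (\xrightarrow{X})^*_A\ s'$ denotes a possibly empty finite sequence of transitions labelled in $X$; $\mathit{reach}(A)$ is the set of states reachable from $\mathit{start}_A$. $A,B$ are composable if $\mathit{act}_A\cap\mathit{act}_B=(\mathit{in}_A\cap\mathit{out}_B)\cup(\mathit{in}_B\cap\mathit{out}_A)=:\mathit{shared}(A,B)$. Synchronous composition $A\otimes B$: states $\mathit{states}_A\times\mathit{states}_B$, initial $(\mathit{start}_A,\mathit{start}_B)$, inputs $(\mathit{in}_A\cup\mathit{in}_B)\setminus\mathit{shared}(A,B)$, outputs $(\mathit{out}_A\cup\mathit{out}_B)\setminus\mathit{shared}(A,B)$, internal $\mathit{int}_A\cup\mathit{int}_B\cup\mathit{shared}(A,B)$; a non-shared action of one component moves only that component; a shared action $a$ yields $(s,t)\xrightarrow{a}(s',t')$ when $s\xrightarrow{a}_A s'$ and $t\xrightarrow{a}_B t'$. For a set $M$, $M^\rhd=\{a^\rhd\mid a\in M\}$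 are fresh names. For $M\subseteq\mathit{out}_A$, $A^\rhd_M$ is $A$ with every $a\in M$ renamed to $a^\rhd$ (an output of $A^\rhd_M$). $A,B$ are asynchronously composable if composable and $\mathit{shared}(A,B)^\rhd\cap(\mathit{act}_A\cup\mathit{act}_B)=\emptyset$. Let $\mathit{out}_{AB}=\mathit{out}_A\cap\mathit{in}_B$, $\mathit{out}_{BA}=\mathit{out}_B\cap\mathit{in}_A$. $\Omega(A)$ is the IOTS with states $(s,q)$, $s\in\mathit{states}_A$, $q\in\mathit{out}_{AB}^*$, initial $(\mathit{start}_A,\epsilon)$, inputs $\mathit{in}_A$, outputs $\mathit{out}_A$, internal $\mathit{int}_A\cup\mathit{out}_{AB}^\rhd$, transitions $(s,q)\xrightarrow{a}(s',q)$ if $s\xrightarrow{a}_A s'$, $a\notin\mathit{out}_{AB}$; $(s,q)\xrightarrow{a^\rhd}(s',qa)$ if $s\xrightarrow{a}_A s'$, $a\in\mathit{out}_{AB}$; $(s,aq)\xrightarrow{a}(s,q)$ for $a\in\mathit{out}_{AB}$. $\Omega(B)$ analogously with $\mathit{out}_{BA}$. $A\otimes_{as}B=\Omega(A)\otimes\Omega(B)$. IOTSes $C,D$ are weakly synchronously compatible if composable and for all $(s_C,s_D)\in\mathit{reach}(C\otimes D)$ and $a\in\mathit{out}_C\cap\mathit{in}_D$ with $s_C\xrightarrow{a}_C s_C'$ there exist $\bar s_D,s_D'$ with $s_D\ (\xrightarrow{\mathit{int}_D})^*_D\ \bar s_D\xrightarrow{a}_D s_D'$, and symmetrically. $A,B$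 are weakly asynchronously compatible if $\Omega(A)$ and $\Omega(B)$ are weakly synchronously compatible. $A\otimes_{as}B$ is asynchronously deadlock-free if every reachable state of $\Omega(A)\otimes\Omega(B)$ has an outgoing transition. $A\otimes B^\rhd_{\mathit{out}_{BA}}$ is autonomously deadlock-free if for each $(s_A,s_B)\in\mathit{reach}(A\otimes B^\rhd_{\mathit{out}_{BA}})$ there is a transition $(s_A,s_B)\xrightarrow{a}(s_A',s_B')$ of $A\otimes B^\rhd_{\mathit{out}_{BA}}$ with $a\notin\mathit{in}_A\cap\mathit{out}_B$. Autonomous deadlock-freeness of $A^\rhd_{\mathit{out}_{AB}}\otimes B$ is defined analogously (a transition with label not in $\mathit{in}_B\cap\mathit{out}_A$ from every reachable state). -}

module Defs where

open import Data.Product using (Σ; ∃; ∃₂; _×_; _,_)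
open import Data.Sum using (_⊎_)
open import Data.List using (List; []; _∷_; _++_; [_])
open import Relation.Nullary using (¬_)
open import Relation.Binary.PropositionalEquality using (_≡_)
open import Relation.Binary.Construct.Closure.ReflexiveTransitive using (Star)

record IOTS (Act : Set) : Set₁ where
  field
    State : Set
    start : State
    In    : Act → Set
    Out   : Act → Set
    Int   : Act → Set
    trans : State → Act → State → Set

open IOTS public

module _ {Act : Set} where

  act : IOTS Act → Act → Set
  act A a = In A a ⊎ Out A a ⊎ Int A a

  WellFormed : IOTS Act → Set
  WellFormed A =
    (∀ a → In A a → Out A a → ⊥') ×
    (∀ a → In A a → Int A a → ⊥') ×
    (∀ a → Out A a → Int A a → ⊥') ×
    (∀ s a s' → trans A s a s' → act A a)
    where
      open import Data.Empty renaming (⊥ to ⊥')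

  Steps : (A : IOTS Act) → (Act → Set) → State A → State A → Set
  Steps A X = Star (λ s s' → Σ Act (λ a → X a × trans A s a s'))

  reach : (A : IOTS Act) → State A → Set
  reach A s = Star (λ s₁ s₂ → Σ Act (λ a → trans A s₁ a s₂)) (start A) s

  shared : IOTS Act → IOTS Act → Act → Set
  shared A B a = (In A a × Out B a) ⊎ (In B a × Out A a)

  Composable : IOTS Act → IOTS Act → Set
  Composable A B =
    (∀ a → act A a → act B a → shared A B a) ×
    (∀ a → shared A B a → act A a × act B a)

  _⊗_ : IOTS Act → IOTS Act → IOTS Act
  A ⊗ B = record
    { State = State A × State B
    ; start = start A , start B
    ; In    = λ a → (In A a ⊎ In B a) × ¬ shared A B a
    ; Out   = λ a → (Out A a ⊎ Out B a) × ¬ shared A B a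
    ; Int   = λ a → Int A a ⊎ Int B a ⊎ shared A B a
    ; trans = λ { (s , t) a (s' , t') →
                  (¬ shared A B a × trans A s a s' × t' ≡ t)
                ⊎ (¬ shared A B a × trans B t a t' × s' ≡ s)
                ⊎ (shared A B a × trans A s a s' × trans B t a t') }
    }

  out[_,_] : IOTS Act → IOTS Act → Act → Set
  out[ A , B ] a = Out A a × In B a

  module _ (▷ : Act → Act) where
    -- ▷ a is the fresh name a^▷

    -- A^▷_M : every a ∈ M (M ⊆ out_A) renamed to a^▷
    rename : IOTS Act → (Act → Set) → IOTS Act
    rename A M = record
      { State = State A
      ; start = start A
      ; In    = In A
      ; Out   = λ b → (Out A b × ¬ M b) ⊎ Σ Act (λ a → M a × b ≡ ▷ a)
      ; Int   = Int A
      ; trans = λ s b s' → (¬ M b × trans A s b s')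
                         ⊎ Σ Act (λ a → M a × b ≡ ▷ a × trans A s a s')
      }

    AsyncComposable : IOTS Act → IOTS Act → Set
    AsyncComposable A B =
      Composable A B ×
      (∀ a → shared A B a → ¬ act A (▷ a) × ¬ act B (▷ a))

    -- Ω(A) with respect to the partner B (queue of out_AB messages)
    Ω : IOTS Act → IOTS Act → IOTS Act
    Ω A B = record
      { State = State A × List Act
      ; start = start A , []
      ; In    = In A
      ; Out   = Out A
      ; Int   = λ a → Int A a ⊎ Σ Act (λ c → out[ A , B ] c × a ≡ ▷ c)
      ; trans = λ { (s , q) a (s' , q') →
                    (¬ out[ A , B ] a × trans A s a s' × q' ≡ q)
                  ⊎ Σ Act (λ c → out[ A , B ] c × a ≡ ▷ c × trans A s c s' × q' ≡ q ++ [ c ])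
                  ⊎ (out[ A , B ] a × s' ≡ s × q ≡ a ∷ q') }
      }

    _⊗as_ : IOTS Act → IOTS Act → IOTS Act
    A ⊗as B = Ω A B ⊗ Ω B A

  WeakSyncCompatible : IOTS Act → IOTS Act → Set
  WeakSyncCompatible C D =
    Composable C D ×
    (∀ sC sD → reach (C ⊗ D) (sC , sD) →
       ∀ a → Out C a → In D a → ∀ sC' → trans C sC a sC' →
       ∃₂ λ s̄D sD' → Steps D (Int D) sD s̄D × trans D s̄D a sD') ×
    (∀ sC sD → reach (C ⊗ D) (sC , sD) →
       ∀ a → Out D a → In C a → ∀ sD' → trans D sD a sD' →
       ∃₂ λ s̄C sC' → Steps C (Int C) sC s̄C × trans C s̄C a sC')

  module _ (▷ : Act → Act) where

    WeakAsyncCompatible : IOTS Act → IOTS Act → Set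
    WeakAsyncCompatible A B = WeakSyncCompatible (Ω ▷ A B) (Ω ▷ B A)

    AsyncDeadlockFree : IOTS Act → IOTS Act → Set
    AsyncDeadlockFree A B =
      ∀ x → reach (_⊗as_ ▷ A B) x → ∃₂ λ a y → trans (_⊗as_ ▷ A B) x a y

    AutonomousDFˡ : IOTS Act → IOTS Act → Set
    AutonomousDFˡ A B =
      ∀ x → reach (A ⊗ rename ▷ B out[ B , A ]) x →
      ∃₂ λ a y → ¬ (In A a × Out B a) × trans (A ⊗ rename ▷ B out[ B , A ]) x a y

    AutonomousDFʳ : IOTS Act → IOTS Act → Set
    AutonomousDFʳ A B =
      ∀ x → reach (rename ▷ A out[ A , B ] ⊗ B) x →
      ∃₂ λ a y → ¬ (In B a × Out A a) × trans (rename ▷ A out[ A , B ] ⊗ B) x a y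

module Submission where

open import Defs
open import Data.Sum using (_⊎_; inj₁; inj₂) renaming (swap to ⊎-swap)
open import Relation.Binary.PropositionalEquality using (_≡_; refl)
open import Data.Product using (Σ; ∃₂; _×_; _,_; proj₁; proj₂) renaming (swap to ×-swap)
open import Data.List using (List; []; _∷_; _++_; [_])
open import Data.Empty using (⊥-elim)
open import Function using (_∘_)
open import Relation.Nullary using (¬_)
open import Relation.Binary.Construct.Closure.ReflexiveTransitive using (Star; ε; _◅_; _◅◅_; gmap)

-- Every reachable state of A ⊗as B is matched by a reachable state of A ⊗ B^▷_{out_BA}:
-- B's component is the same and A's component lags behind by exactly the messages still
-- in A's queue, since in A ⊗ B^▷ B's sends are asynchronous (renamed) while A's sends
-- synchronise with their reception.  Hence a nonempty queue of A can always be consumed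
-- (B either moves internally or, by weak compatibility, receives the head), and if A's
-- queue is empty the autonomous move of A ⊗ B^▷ available at the matching state can be
-- replayed in A ⊗as B.  The case of A^▷ ⊗ B is the mirror image.

Star-invariant : {S : Set} {R : S → S → Set} (P : S → Set) →
  (∀ {x y} → P x → R x y → P y) → ∀ {x y} → P x → Star R x y → P y
Star-invariant P step px ε        = px
Star-invariant P step px (r ◅ rs) = Star-invariant P step (step px r) rs

module _ {Act : Set} where

  ⊗-swap : (C D : IOTS Act) → ∀ {s t a s' t'} →
    trans (C ⊗ D) (s , t) a (s' , t') → trans (D ⊗ C) (t , s) a (t' , s')
  ⊗-swap C D (inj₁ (n , tC , e))        = inj₂ (inj₁ (n ∘ ⊎-swap , tC , e))
  ⊗-swap C D (inj₂ (inj₁ (n , tD , e))) = inj₁ (n ∘ ⊎-swap , tD , e)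
  ⊗-swap C D (inj₂ (inj₂ (h , tC , tD))) = inj₂ (inj₂ (⊎-swap h , tD , tC))

  reach-⊗-swap : (C D : IOTS Act) → ∀ {s t} → reach (C ⊗ D) (s , t) → reach (D ⊗ C) (t , s)
  reach-⊗-swap C D = gmap ×-swap (λ (a , t) → a , ⊗-swap C D t)

  Composable-sym : (C D : IOTS Act) → Composable C D → Composable D C
  Composable-sym C D (disjoint , shared-act) =
    (λ a x y → ⊎-swap (disjoint a y x)) ,
    (λ a sh → ×-swap (shared-act a (⊎-swap sh)))

  WeakSyncCompatible-sym : (C D : IOTS Act) → WeakSyncCompatible C D → WeakSyncCompatible D C
  WeakSyncCompatible-sym C D (comp , recvD , recvC) =
    Composable-sym C D comp ,
    (λ sD sC r → recvC sC sD (reach-⊗-swap D C r)) ,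
    (λ sD sC r → recvD sC sD (reach-⊗-swap D C r))

  module _ (▷ : Act → Act) (A B : IOTS Act) where

    AsyncComposable-sym : AsyncComposable ▷ A B → AsyncComposable ▷ B A
    AsyncComposable-sym (comp , fresh) =
      Composable-sym A B comp , (λ a sh → ×-swap (fresh a (⊎-swap sh)))

    WeakAsyncCompatible-sym : WeakAsyncCompatible ▷ A B → WeakAsyncCompatible ▷ B A
    WeakAsyncCompatible-sym = WeakSyncCompatible-sym (Ω ▷ A B) (Ω ▷ B A)

    AsyncDeadlockFree-sym : AsyncDeadlockFree ▷ B A → AsyncDeadlockFree ▷ A B
    AsyncDeadlockFree-sym df (x , y) r with df (y , x) (reach-⊗-swap (Ω ▷ A B) (Ω ▷ B A) r)
    ... | a , (y' , x') , t = a , (x' , y') , ⊗-swap (Ω ▷ B A) (Ω ▷ A B) t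

    AutonomousDFʳ⇒AutonomousDFˡ : AutonomousDFʳ ▷ A B → AutonomousDFˡ ▷ B A
    AutonomousDFʳ⇒AutonomousDFˡ df (y , x) r
      with df (x , y) (reach-⊗-swap B (rename ▷ A out[ A , B ]) r)
    ... | a , (x' , y') , autonomous , t =
      a , (y' , x') , autonomous , ⊗-swap (rename ▷ A out[ A , B ]) B t

module Simulation {Act : Set} (▷ : Act → Act) (A B : IOTS Act)
                  (wfA : WellFormed A) (wfB : WellFormed B)
                  (ac : AsyncComposable ▷ A B) (wc : WeakAsyncCompatible ▷ A B) where

  ΩA ΩB B▷ Async Sync : IOTS Act
  ΩA    = Ω ▷ A B
  ΩB    = Ω ▷ B A
  B▷    = rename ▷ B out[ B , A ]
  Async = ΩA ⊗ ΩB
  Sync  = A ⊗ B▷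

  Enabled : State Async → Set
  Enabled x = ∃₂ λ a y → trans Async x a y

  outAB⇒shared : ∀ {a} → out[ A , B ] a → shared A B a
  outAB⇒shared (o , i) = inj₂ (i , o)

  outBA⇒shared : ∀ {a} → out[ B , A ] a → shared A B a
  outBA⇒shared (o , i) = inj₁ (i , o)

  shared⇒actA : ∀ {a} → shared A B a → act A a
  shared⇒actA (inj₁ (i , _)) = inj₁ i
  shared⇒actA (inj₂ (_ , o)) = inj₂ (inj₁ o)

  ▷-fresh : ∀ {c} → shared A B c → ¬ act A (▷ c)
  ▷-fresh {c} sh = proj₁ (proj₂ ac c sh)

  ▷-unshared : ∀ {c} → shared A B c → ¬ shared A B (▷ c)
  ▷-unshared sh sh▷ = ▷-fresh sh (shared⇒actA sh▷)

  sharedSync⇒outAB : ∀ {a} → shared A B▷ a → out[ A , B ] a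
  sharedSync⇒outAB (inj₁ (i , inj₁ (o , ¬outBA)))   = ⊥-elim (¬outBA (o , i))
  sharedSync⇒outAB (inj₁ (i , inj₂ (c , oc , refl))) = ⊥-elim (▷-fresh (outBA⇒shared oc) (inj₁ i))
  sharedSync⇒outAB (inj₂ (i , o))                    = o , i

  outAB⇒sharedSync : ∀ {a} → out[ A , B ] a → shared A B▷ a
  outAB⇒sharedSync = inj₂ ∘ ×-swap

  unsharedSync : ∀ {a} → ¬ out[ A , B ] a → ¬ shared A B▷ a
  unsharedSync ¬out sh = ¬out (sharedSync⇒outAB sh)

  autonomous⇒unshared : ∀ {a} → ¬ (In A a × Out B a) → ¬ shared A B▷ a → ¬ shared A B a
  autonomous⇒unshared aut _   (inj₁ io) = aut io
  autonomous⇒unshared _   ¬sh (inj₂ io) = ¬sh (inj₂ io)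

  internalB-unshared : ∀ {b} → Int ΩB b → ¬ shared A B b
  internalB-unshared {b} (inj₁ int) (inj₁ (_ , o)) = proj₁ (proj₂ (proj₂ wfB)) b o int
  internalB-unshared {b} (inj₁ int) (inj₂ (i , _)) = proj₁ (proj₂ wfB) b i int
  internalB-unshared (inj₂ (c , oc , refl))        = ▷-unshared (outBA⇒shared oc)

  -- SendRun s₀ q s: a run of A from s₀ to s whose sends to B are exactly q; in the
  -- simulation A's component of Sync sits at s₀ while that of Async is at s with queue q.
  data SendRun : State A → List Act → State A → Set where
    []    : ∀ {s} → SendRun s [] s
    local : ∀ {s a s' q s''} → trans A s a s' → ¬ out[ A , B ] a →
            SendRun s' q s'' → SendRun s q s''
    send  : ∀ {s a s' q s''} → trans A s a s' → out[ A , B ] a →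
            SendRun s' q s'' → SendRun s (a ∷ q) s''

  SendRun-head : ∀ {s₀ a q s} → SendRun s₀ (a ∷ q) s → out[ A , B ] a
  SendRun-head (local _ _ p) = SendRun-head p
  SendRun-head (send _ o _)  = o

  SendRun-▻local : ∀ {s₀ q s a s'} → SendRun s₀ q s → trans A s a s' → ¬ out[ A , B ] a →
    SendRun s₀ q s'
  SendRun-▻local []            t n = local t n []
  SendRun-▻local (local x n p) t m = local x n (SendRun-▻local p t m)
  SendRun-▻local (send x o p)  t m = send x o (SendRun-▻local p t m)

  SendRun-▻send : ∀ {s₀ q s a s'} → SendRun s₀ q s → trans A s a s' → out[ A , B ] a →
    SendRun s₀ (q ++ [ a ]) s'
  SendRun-▻send []            t o = send t o []
  SendRun-▻send (local x n p) t o = local x n (SendRun-▻send p t o)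
  SendRun-▻send (send x o p)  t m = send x o (SendRun-▻send p t m)

  sync-localA : ∀ {s s' t a} → trans A s a s' → ¬ out[ A , B ] a → trans Sync (s , t) a (s' , t)
  sync-localA tA n = inj₁ (unsharedSync n , tA , refl)

  reach-SendRun-[] : ∀ {s₀ s t} → SendRun s₀ [] s → reach Sync (s₀ , t) → reach Sync (s , t)
  reach-SendRun-[] []            r = r
  reach-SendRun-[] (local x n p) r = reach-SendRun-[] p (r ◅◅ (_ , sync-localA x n) ◅ ε)

  reach-SendRun-receive : ∀ {s₀ a q s t t'} → SendRun s₀ (a ∷ q) s → reach Sync (s₀ , t) →
    trans B t a t' → ¬ out[ B , A ] a → Σ (State A) λ s₀' → reach Sync (s₀' , t') × SendRun s₀' q s
  reach-SendRun-receive (local x n p) r tB n' =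
    reach-SendRun-receive p (r ◅◅ (_ , sync-localA x n) ◅ ε) tB n'
  reach-SendRun-receive (send x o p) r tB n' =
    _ , r ◅◅ (_ , inj₂ (inj₂ (outAB⇒sharedSync o , x , inj₁ (n' , tB)))) ◅ ε , p

  Simulated : State Async → Set
  Simulated ((sA , qA) , (sB , _)) = Σ (State A) λ s₀ → reach Sync (s₀ , sB) × SendRun s₀ qA sA

  simulate-localA : ∀ {sA qA sA' qA' s₀ a} → ¬ shared A B a →
    trans ΩA (sA , qA) a (sA' , qA') → SendRun s₀ qA sA → SendRun s₀ qA' sA'
  simulate-localA _   (inj₁ (n , tA , refl))                   p = SendRun-▻local p tA n
  simulate-localA _   (inj₂ (inj₁ (c , oc , refl , tA , refl))) p = SendRun-▻send p tA oc
  simulate-localA ¬sh (inj₂ (inj₂ (oc , _)))                    _ = ⊥-elim (¬sh (outAB⇒shared oc))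

  simulate-localB : ∀ {sB qB sB' qB' s₀ a} → ¬ shared A B a →
    trans ΩB (sB , qB) a (sB' , qB') → reach Sync (s₀ , sB) → reach Sync (s₀ , sB')
  simulate-localB ¬sh (inj₁ (n , tB , refl)) r =
    r ◅◅ (_ , inj₂ (inj₁ (unsharedSync (¬sh ∘ outAB⇒shared) , inj₁ (n , tB) , refl))) ◅ ε
  simulate-localB _ (inj₂ (inj₁ (c , oc , refl , tB , refl))) r =
    r ◅◅ (_ , inj₂ (inj₁ (unsharedSync (▷-fresh (outBA⇒shared oc) ∘ inj₂ ∘ inj₁ ∘ proj₁) ,
                         inj₂ (c , oc , refl , tB) , refl))) ◅ ε
  simulate-localB ¬sh (inj₂ (inj₂ (oc , _))) _ = ⊥-elim (¬sh (outBA⇒shared oc))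

  simulate-sync : ∀ {sA qA sB qB sA' qA' sB' qB' a} → shared A B a →
    trans ΩA (sA , qA) a (sA' , qA') → trans ΩB (sB , qB) a (sB' , qB') →
    Simulated ((sA , qA) , (sB , qB)) → Simulated ((sA' , qA') , (sB' , qB'))
  simulate-sync _ (inj₁ (n , tA , refl)) (inj₂ (inj₂ (_ , refl , refl))) (s₀ , r , p) =
    s₀ , r , SendRun-▻local p tA n
  simulate-sync _ (inj₂ (inj₂ (_ , refl , refl))) (inj₁ (n , tB , refl)) (_ , r , p) =
    reach-SendRun-receive p r tB n
  simulate-sync sh (inj₂ (inj₁ (c , oc , refl , _))) _ _ = ⊥-elim (▷-unshared (outAB⇒shared oc) sh)
  simulate-sync sh _ (inj₂ (inj₁ (c , oc , refl , _))) _ = ⊥-elim (▷-unshared (outBA⇒shared oc) sh)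
  simulate-sync (inj₁ (i , o)) (inj₁ _) (inj₁ (n , _)) _ = ⊥-elim (n (o , i))
  simulate-sync (inj₂ (i , o)) (inj₁ (n , _)) (inj₁ _) _ = ⊥-elim (n (o , i))
  simulate-sync {a = a} _ (inj₂ (inj₂ (oAB , _))) (inj₂ (inj₂ (oBA , _))) _ =
    ⊥-elim (proj₁ wfA a (proj₂ oBA) (proj₁ oAB))

  simulate-step : ∀ {x y} → Simulated x → Σ Act (λ a → trans Async x a y) → Simulated y
  simulate-step (s₀ , r , p) (_ , inj₁ (¬sh , tA , refl))        = s₀ , r , simulate-localA ¬sh tA p
  simulate-step (s₀ , r , p) (_ , inj₂ (inj₁ (¬sh , tB , refl))) = s₀ , simulate-localB ¬sh tB r , p
  simulate-step sim         (_ , inj₂ (inj₂ (sh , tA , tB)))    = simulate-sync sh tA tB sim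

  reach⇒Simulated : ∀ {x} → reach Async x → Simulated x
  reach⇒Simulated = Star-invariant Simulated simulate-step (start A , ε , [])

  progress-sending : ∀ {sA a q sB qB} → reach Async ((sA , a ∷ q) , (sB , qB)) →
    Enabled ((sA , a ∷ q) , (sB , qB))
  progress-sending {sA} {a} {q} {sB} {qB} r
    with SendRun-head (proj₂ (proj₂ (reach⇒Simulated r)))
  ... | oc with proj₁ (proj₂ wc) (sA , a ∷ q) (sB , qB) r a (proj₁ oc) (proj₂ oc) (sA , q)
                  (inj₂ (inj₂ (oc , refl , refl)))
  ... | _ , _ , ε , tB =
    a , _ , inj₂ (inj₂ (outAB⇒shared oc , inj₂ (inj₂ (oc , refl , refl)) , tB))
  ... | _ , _ , (b , int , tB) ◅ _ , _ =
    b , _ , inj₂ (inj₁ (internalB-unshared int , tB , refl))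

  progress-autonomous : AutonomousDFˡ ▷ A B → ∀ {sA sB qB} → reach Async ((sA , []) , (sB , qB)) →
    Enabled ((sA , []) , (sB , qB))
  progress-autonomous df {sA} {sB} r with reach⇒Simulated r
  ... | _ , rS , p with df (sA , sB) (reach-SendRun-[] p rS)
  ... | a , _ , aut , inj₁ (¬sh , tA , refl) =
    a , _ , inj₁ (autonomous⇒unshared aut ¬sh , inj₁ (¬sh ∘ outAB⇒sharedSync , tA , refl) , refl)
  ... | a , _ , aut , inj₂ (inj₁ (¬sh , inj₁ (n , tB) , refl)) =
    a , _ , inj₂ (inj₁ (autonomous⇒unshared aut ¬sh , inj₁ (n , tB , refl) , refl))
  ... | _ , _ , _ , inj₂ (inj₁ (_ , inj₂ (c , oc , refl , tB) , refl)) =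
    ▷ c , _ , inj₂ (inj₁ (▷-unshared (outBA⇒shared oc) ,
                         inj₂ (inj₁ (c , oc , refl , tB , refl)) , refl))
  ... | a , _ , aut , inj₂ (inj₂ (sh , tA , _)) =
    ▷ a , _ , inj₁ (▷-unshared (outAB⇒shared oc) , inj₂ (inj₁ (a , oc , refl , tA , refl)) , refl)
    where oc : out[ A , B ] a
          oc = sharedSync⇒outAB sh

  asyncDeadlockFree : AutonomousDFˡ ▷ A B → AsyncDeadlockFree ▷ A B
  asyncDeadlockFree df ((_ , [])    , _) r = progress-autonomous df r
  asyncDeadlockFree _  ((_ , _ ∷ _) , _) r = progress-sending r

theorem6p6 : {Act : Set} (▷ : Act → Act) →
    (∀ a b → ▷ a ≡ ▷ b → a ≡ b) →
    (A B : IOTS Act) → WellFormed A → WellFormed B →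
    AsyncComposable ▷ A B →
    WeakAsyncCompatible ▷ A B →
    (AutonomousDFˡ ▷ A B ⊎ AutonomousDFʳ ▷ A B) →
    AsyncDeadlockFree ▷ A B
theorem6p6 ▷ _ A B wfA wfB ac wc (inj₁ df) = Simulation.asyncDeadlockFree ▷ A B wfA wfB ac wc df
theorem6p6 ▷ _ A B wfA wfB ac wc (inj₂ df) =
  AsyncDeadlockFree-sym ▷ A B
    (Simulation.asyncDeadlockFree ▷ B A wfB wfA
      (AsyncComposable-sym ▷ A B ac) (WeakAsyncCompatible-sym ▷ A B wc)
      (AutonomousDFʳ⇒AutonomousDFˡ ▷ A B df))
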